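{- For $n\ge4$, let $M(C_n)$ be the middle graph of the cycle $C_n$. Then $\chi_2(M(C_n))=3$ and $\chi_3(M(C_n))=4$.
   Context: The middle graph $M(G)$ of $G$ has vertex set $V(G)\cup E(G)$, two of its vertices being adjacent iff they are two edges of $G$ sharing an endpoint, or one is a vertex and the other an edge of $G$ incident with it. All graphs are simple, connected and undirected; $N_G(v)$ is the open neighborhood, $d(v)=|N_G(v)|$, $\Delta$ the maximum degree. For a coloring $c$ and vertex set $S$, $c(S)=\{c(u):u\in S\}$. For integers $k>0$ and $0<r\le\Delta(G)$ with $r\le k$, a conditional $(k,r)$-coloring of $G$ is a surjective map $c:V(G)\to\{1,\dots,k\}$ such that (C1) $c(u)\ne c(v)$ whenever $uv\in E(G)$, and (C2) $|c(N_G(v))|\ge\min\{d(v),r\}$ for every vertex $v$. $\chi_r(G)$ is the smallest $k$ for which $G$ has a conditional $(k,r)$-coloring. -}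

module Defs where

open import Data.Nat using (ℕ; zero; suc; _+_; _≤_; _<_; _⊔_)
open import Data.Nat.DivMod using (_mod_)
open import Data.Fin using (Fin; toℕ; splitAt)
open import Data.Fin.Properties using () renaming (_≟_ to _≟ᶠ_)
open import Data.Bool using (Bool; true; false; _∧_; _∨_; not; if_then_else_)
open import Data.List using (List; allFin; foldr; map)
open import Data.Nat.ListAction using (sum)
open import Data.Bool.ListAction using (any)
open import Data.Sum using (_⊎_; inj₁; inj₂)
open import Data.Product using (_×_; _,_; proj₁; proj₂; ∃)
open import Relation.Binary.PropositionalEquality using (_≡_; _≢_)
open import Relation.Nullary using (¬_)
open import Relation.Nullary.Decidable using (⌊_⌋)

record Graph : Set where
  field
    size : ℕ
    adj  : Fin size → Fin size → Bool
open Graph public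

count : ∀ {n} → (Fin n → Bool) → ℕ
count {n} p = sum (map (λ i → if p i then 1 else 0) (allFin n))

deg : (G : Graph) → Fin (size G) → ℕ
deg G v = count (adj G v)

Δ : Graph → ℕ
Δ G = foldr (λ v m → deg G v ⊔ m) 0 (allFin (size G))

nbrColours : (G : Graph) {k : ℕ} → (Fin (size G) → Fin k) → Fin (size G) → ℕ
nbrColours G {k} c v =
  count {k} (λ j → any (λ u → adj G v u ∧ ⌊ c u ≟ᶠ j ⌋) (allFin (size G)))

min : ℕ → ℕ → ℕ
min zero    _       = zero
min (suc a) zero    = zero
min (suc a) (suc b) = suc (min a b)

record ConditionalColoring (G : Graph) (k r : ℕ) : Set where
  field
    r-pos  : 0 < r
    r≤Δ    : r ≤ Δ G
    r≤k    : r ≤ k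
    colour : Fin (size G) → Fin k
    surj   : ∀ (j : Fin k) → ∃ λ v → colour v ≡ j
    C1     : ∀ u v → adj G u v ≡ true → colour u ≢ colour v
    C2     : ∀ v → min (deg G v) r ≤ nbrColours G colour v

χ[_]_≡_ : ℕ → Graph → ℕ → Set
χ[ r ] G ≡ k = ConditionalColoring G k r × (∀ k' → k' < k → ¬ ConditionalColoring G k' r)

-- Middle graph of a graph given by n vertices and m edges, edge e having
-- endpoints ends e.  Vertices of M(G): Fin (n + m), the first n being the
-- vertices of G and the last m the edges of G.
middle : (n m : ℕ) → (Fin m → Fin n × Fin n) → Graph
middle n m ends = record { size = n + m ; adj = λ x y → a (splitAt n x) (splitAt n y) }
  where
    eqF : ∀ {t} → Fin t → Fin t → Bool
    eqF i j = ⌊ i ≟ᶠ j ⌋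
    inc : Fin n → Fin m → Bool
    inc v e = eqF v (proj₁ (ends e)) ∨ eqF v (proj₂ (ends e))
    a : Fin n ⊎ Fin m → Fin n ⊎ Fin m → Bool
    a (inj₁ v) (inj₁ w) = false
    a (inj₁ v) (inj₂ e) = inc v e
    a (inj₂ e) (inj₁ v) = inc v e
    a (inj₂ e) (inj₂ f) = not (eqF e f) ∧
      (inc (proj₁ (ends e)) f ∨ inc (proj₂ (ends e)) f)

cycleEdges : (n : ℕ) → Fin n → Fin n × Fin n
cycleEdges zero    ()
cycleEdges (suc n) i = i , (suc (toℕ i) mod suc n)

middleCycle : ℕ → Graph
middleCycle n = middle n n (cycleEdges n)

-- A vertex of degree at least r sees r colours in a conditional (k,r)-colouring, none of them
-- its own, so r < k: χ_r(G) = r + 1 as soon as a conditional (r+1,r)-colouring exists.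
-- For M(C_n) colour the edges e₀, e₁, … of C_n by 2, 0, 1, 0, 1, …, a proper colouring of the
-- cycle formed by the edge-vertices.  Every vertex of M(C_n) lies in a triangle, so every proper
-- colouring satisfies the condition for r = 2; with three colours the vertices of C_n take 2,
-- except v₁ ↦ 1 and v₀ ↦ whichever of 0, 1 the edge e_{n-1} does not have.  For r = 3 the
-- vertices take 3, 1, 3, 2, 3, 2, …: a vertex-vertex has degree 2, and each edge-vertex sees
-- three colours among its four neighbours.

module Submission where

open import Defs
open import Data.Bool using (Bool; true; false; _∧_; _∨_; not; if_then_else_; T)
open import Data.Bool.ListAction using (any)
open import Data.Bool.Properties using (T-≡; T-∧; ∨-zeroʳ)
open import Data.Empty using (⊥-elim)
open import Data.Fin using (Fin; zero; suc; toℕ; fromℕ; inject₁; splitAt; _↑ˡ_; _↑ʳ_; #_)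
open import Data.Fin.Properties
  using (_≟_; toℕ-injective; toℕ-fromℕ<; toℕ-fromℕ; toℕ-inject₁; toℕ<n; ↑ˡ-injective;
         splitAt-↑ˡ; splitAt-↑ʳ; splitAt⁻¹-↑ˡ; splitAt⁻¹-↑ʳ)
open import Data.Fin.Subset using (Subset; inside; outside; ∣_∣; ⁅_⁆; _∪_; _-_; ⊥; _∉_)
  renaming (_∈_ to _∈ₛ_)
open import Data.Fin.Subset.Properties
  using (∣p∣≤∣x∷p∣; x∈p⇒∣p-x∣<∣p∣; x∈p∧x≢y⇒x∈p-y; p⊂q⇒∣p∣<∣q∣; ∣⊤∣≡n; ∈⊤; ⊆⊤;
         p⊆q⇒∣p∣≤∣q∣; x∈p∪q⁺; ∣⊥∣≡0; x∈⁅x⁆; ∣⁅x⁆∣≡1)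
open import Data.List using (List; []; _∷_; length; map; allFin; foldr; deduplicate)
open import Data.List.Properties using (map-tabulate)
open import Data.List.Membership.Propositional using (_∈_)
open import Data.List.Membership.Propositional.Properties using (∈-allFin; ∈-map⁻; ∈-deduplicate⁻)
open import Data.List.Relation.Unary.All as All using (All; []; _∷_)
open import Data.List.Relation.Unary.Any as Any using (here; there)
open import Data.List.Relation.Unary.Any.Properties using (any⁺; any⁻)
open import Data.List.Relation.Unary.Unique.Propositional using (Unique; []; _∷_)
import Data.List.Relation.Unary.Unique.DecPropositional.Properties as UniqueDec
open import Data.Nat using (ℕ; zero; suc; _+_; _≤_; _<_; _⊔_; _⊓_; _%_; z≤n; s≤s)
open import Data.Nat.Properties
  using (≤-trans; ≤-reflexive; +-monoʳ-≤; +-suc; ⊔-sel; m≤m⊔n; m≤n⊔m; m≥n⇒m⊓n≡n; m⊓n≤m; m⊓n≤n;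
         <⇒≱; m<1+n⇒m≤n; m≤n⇒m<n∨m≡n; suc-injective; 1+n≢n; ≤-pred; module ≤-Reasoning)
open import Data.Nat.DivMod using (m<n⇒m%n≡m; n%n≡0)
open import Data.Nat.ListAction using (sum)
open import Data.Product using (_×_; _,_; proj₁; proj₂; ∃; ∃₂)
open import Data.Sum as Sum using (_⊎_; inj₁; inj₂; [_,_]′)
open import Data.Vec as Vec using ([]; _∷_)
open import Data.Vec.Properties using (lookup∘tabulate; []=⇒lookup; lookup⇒[]=)
open import Function using (_∘_; id; Equivalence)
open import Relation.Binary.PropositionalEquality
  using (_≡_; _≢_; refl; sym; trans; cong; subst; ≢-sym; module ≡-Reasoning)
open import Relation.Nullary using (yes; no)
open import Relation.Nullary.Decidable using (⌊_⌋; toWitness; fromWitness)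

-- Counting

∣p∪q∣≤∣p∣+∣q∣ : ∀ {n} (p q : Subset n) → ∣ p ∪ q ∣ ≤ ∣ p ∣ + ∣ q ∣
∣p∪q∣≤∣p∣+∣q∣ []            []            = z≤n
∣p∪q∣≤∣p∣+∣q∣ (inside  ∷ p) (t       ∷ q) =
  s≤s (≤-trans (∣p∪q∣≤∣p∣+∣q∣ p q) (+-monoʳ-≤ ∣ p ∣ (∣p∣≤∣x∷p∣ t q)))
∣p∪q∣≤∣p∣+∣q∣ (outside ∷ p) (inside  ∷ q) =
  ≤-trans (s≤s (∣p∪q∣≤∣p∣+∣q∣ p q)) (≤-reflexive (sym (+-suc ∣ p ∣ ∣ q ∣)))
∣p∪q∣≤∣p∣+∣q∣ (outside ∷ p) (outside ∷ q) = ∣p∪q∣≤∣p∣+∣q∣ p q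

fromList : ∀ {n} → List (Fin n) → Subset n
fromList []       = ⊥
fromList (x ∷ xs) = ⁅ x ⁆ ∪ fromList xs

∈-fromList⁺ : ∀ {n} {i : Fin n} {xs} → i ∈ xs → i ∈ₛ fromList xs
∈-fromList⁺ {i = i} (here refl) = x∈p∪q⁺ (inj₁ (x∈⁅x⁆ i))
∈-fromList⁺ (there i∈xs)        = x∈p∪q⁺ (inj₂ (∈-fromList⁺ i∈xs))

∣fromList∣≤length : ∀ {n} (xs : List (Fin n)) → ∣ fromList xs ∣ ≤ length xs
∣fromList∣≤length {n} [] = ≤-reflexive (∣⊥∣≡0 n)
∣fromList∣≤length (x ∷ xs) = begin
  ∣ ⁅ x ⁆ ∪ fromList xs ∣      ≤⟨ ∣p∪q∣≤∣p∣+∣q∣ ⁅ x ⁆ (fromList xs) ⟩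
  ∣ ⁅ x ⁆ ∣ + ∣ fromList xs ∣  ≡⟨ cong (_+ ∣ fromList xs ∣) (∣⁅x⁆∣≡1 x) ⟩
  suc ∣ fromList xs ∣          ≤⟨ s≤s (∣fromList∣≤length xs) ⟩
  suc (length xs)              ∎
  where open ≤-Reasoning

length≤∣p∣ : ∀ {n} {p : Subset n} {xs} → Unique xs → All (_∈ₛ p) xs → length xs ≤ ∣ p ∣
length≤∣p∣ []            []           = z≤n
length≤∣p∣ {p = p} {x ∷ xs} (x≢xs ∷ uniq) (x∈p ∷ xs⊆p) =
  ≤-trans (s≤s (length≤∣p∣ uniq xs⊆p-x)) (x∈p⇒∣p-x∣<∣p∣ x∈p)
  where
  xs⊆p-x : All (_∈ₛ p - x) xs
  xs⊆p-x = All.zipWith (λ (y∈p , x≢y) → x∈p∧x≢y⇒x∈p-y y∈p (≢-sym x≢y)) (xs⊆p , x≢xs)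

∣p∣<n : ∀ {n} {p : Subset n} {i} → i ∉ p → ∣ p ∣ < n
∣p∣<n {n} {p} {i} i∉p = subst (∣ p ∣ <_) (∣⊤∣≡n n) (p⊂q⇒∣p∣<∣q∣ (⊆⊤ , i , ∈⊤ , i∉p))

toSubset : ∀ {k} → (Fin k → Bool) → Subset k
toSubset = Vec.tabulate

∈-toSubset⁺ : ∀ {k} {p : Fin k → Bool} {i} → p i ≡ true → i ∈ₛ toSubset p
∈-toSubset⁺ {p = p} {i} pi = lookup⇒[]= i (toSubset p) (trans (lookup∘tabulate p i) pi)

∈-toSubset⁻ : ∀ {k} {p : Fin k → Bool} {i} → i ∈ₛ toSubset p → p i ≡ true
∈-toSubset⁻ {p = p} {i} i∈p = trans (sym (lookup∘tabulate p i)) ([]=⇒lookup i∈p)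

count-suc : ∀ {k} (p : Fin (suc k) → Bool) → count p ≡ (if p zero then 1 else 0) + count (p ∘ suc)
count-suc {k} p = cong ((if p zero then 1 else 0) +_) (cong sum
  (trans (map-tabulate suc indicator) (sym (map-tabulate id (indicator ∘ suc)))))
  where
  indicator : Fin (suc k) → ℕ
  indicator i = if p i then 1 else 0

count≡∣toSubset∣ : ∀ {k} (p : Fin k → Bool) → count p ≡ ∣ toSubset p ∣
count≡∣toSubset∣ {zero}  p = refl
count≡∣toSubset∣ {suc k} p rewrite count-suc p | count≡∣toSubset∣ (p ∘ suc) with p zero
... | true  = refl
... | false = refl

length≤count : ∀ {k} {p : Fin k → Bool} {xs} → Unique xs → All (λ i → p i ≡ true) xs →
  length xs ≤ count p
length≤count {p = p} uniq pxs =
  subst (_ ≤_) (sym (count≡∣toSubset∣ p)) (length≤∣p∣ uniq (All.map ∈-toSubset⁺ pxs))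

count≤length : ∀ {k} {p : Fin k → Bool} xs → (∀ {i} → p i ≡ true → i ∈ xs) →
  count p ≤ length xs
count≤length {p = p} xs p⊆xs = begin
  count p              ≡⟨ count≡∣toSubset∣ p ⟩
  ∣ toSubset p ∣       ≤⟨ p⊆q⇒∣p∣≤∣q∣ (∈-fromList⁺ ∘ p⊆xs ∘ ∈-toSubset⁻) ⟩
  ∣ fromList xs ∣      ≤⟨ ∣fromList∣≤length xs ⟩
  length xs            ∎
  where open ≤-Reasoning

count<size : ∀ {k} {p : Fin k → Bool} {i} → p i ≢ true → count p < k
count<size {p = p} pi≢true =
  subst (_< _) (sym (count≡∣toSubset∣ p)) (∣p∣<n (pi≢true ∘ ∈-toSubset⁻))

-- Degrees and colours of neighbourhoods

Proper : (G : Graph) {k : ℕ} → (Fin (size G) → Fin k) → Set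
Proper G c = ∀ u v → adj G u v ≡ true → c u ≢ c v

≤foldr-⊔ : ∀ {A : Set} (f : A → ℕ) {x xs} → x ∈ xs → f x ≤ foldr (λ y m → f y ⊔ m) 0 xs
≤foldr-⊔ f {xs = y ∷ _} (here refl) = m≤m⊔n (f y) _
≤foldr-⊔ f {xs = y ∷ _} (there x∈xs) = ≤-trans (≤foldr-⊔ f x∈xs) (m≤n⊔m (f y) _)

foldr-⊔-attained : ∀ {A : Set} (f : A → ℕ) xs {r} → 0 < r → r ≤ foldr (λ y m → f y ⊔ m) 0 xs →
  ∃ λ x → r ≤ f x
foldr-⊔-attained f []       0<r r≤0 = ⊥-elim (<⇒≱ 0<r r≤0)
foldr-⊔-attained f (x ∷ xs) 0<r r≤max with ⊔-sel (f x) (foldr (λ y m → f y ⊔ m) 0 xs)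
... | inj₁ eq = x , subst (_ ≤_) eq r≤max
... | inj₂ eq = foldr-⊔-attained f xs 0<r (subst (_ ≤_) eq r≤max)

module _ (G : Graph) where

  deg≤Δ : ∀ v → deg G v ≤ Δ G
  deg≤Δ v = ≤foldr-⊔ (deg G) (∈-allFin v)

  ≤Δ⇒≤deg : ∀ {r} → 0 < r → r ≤ Δ G → ∃ λ v → r ≤ deg G v
  ≤Δ⇒≤deg = foldr-⊔-attained (deg G) (allFin (size G))

  length≤deg : ∀ v {us} → Unique us → All (λ u → adj G v u ≡ true) us → length us ≤ deg G v
  length≤deg _ = length≤count

  deg≤length : ∀ v us → (∀ {u} → adj G v u ≡ true → u ∈ us) → deg G v ≤ length us
  deg≤length _ = count≤length

  module _ {k : ℕ} (c : Fin (size G) → Fin k) where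

    hasNeighbourColoured : Fin (size G) → Fin k → Bool
    hasNeighbourColoured v j = any (λ u → adj G v u ∧ ⌊ c u ≟ j ⌋) (allFin (size G))

    hasNeighbourColoured⁺ : ∀ {v u} → adj G v u ≡ true → hasNeighbourColoured v (c u) ≡ true
    hasNeighbourColoured⁺ {v} {u} vu = Equivalence.to T-≡ (any⁺ _ (Any.map witness (∈-allFin u)))
      where
      witness : ∀ {w} → u ≡ w → T (adj G v w ∧ ⌊ c w ≟ c u ⌋)
      witness refl = Equivalence.from T-∧ (Equivalence.from T-≡ vu , fromWitness refl)

    hasNeighbourColoured⁻ : ∀ {v j} → hasNeighbourColoured v j ≡ true →
      ∃ λ u → adj G v u ≡ true × c u ≡ j
    hasNeighbourColoured⁻ {v} h
      with Any.satisfied (any⁻ _ (allFin (size G)) (Equivalence.from T-≡ h))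
    ... | u , vu∧cu≡j with Equivalence.to T-∧ vu∧cu≡j
    ...   | vu , cu≡j = u , Equivalence.to T-≡ vu , toWitness cu≡j

    length≤nbrColours : ∀ {v cs} → Unique cs → All (λ j → ∃ λ u → adj G v u ≡ true × c u ≡ j) cs →
      length cs ≤ nbrColours G c v
    length≤nbrColours uniq seen =
      length≤count uniq (All.map (λ { (u , vu , refl) → hasNeighbourColoured⁺ vu }) seen)

    nbrColours<k : Proper G c → ∀ v → nbrColours G c v < k
    nbrColours<k proper v = count<size λ h →
      let u , vu , cu≡cv = hasNeighbourColoured⁻ h in proper v u vu (sym cu≡cv)

    triangle⇒2≤nbrColours : Proper G c → ∀ v {u w} → adj G v u ≡ true → adj G v w ≡ true →
      adj G u w ≡ true → 2 ≤ nbrColours G c v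
    triangle⇒2≤nbrColours proper _ {u} {w} vu vw uw =
      length≤nbrColours ((proper u w uw ∷ []) ∷ [] ∷ []) ((u , vu , refl) ∷ (w , vw , refl) ∷ [])

    distinctColours≤nbrColours : ∀ v us → All (λ u → adj G v u ≡ true) us →
      length (deduplicate _≟_ (map c us)) ≤ nbrColours G c v
    distinctColours≤nbrColours _ us adjacent =
      length≤nbrColours (UniqueDec.deduplicate-! _≟_ (map c us))
        (All.tabulate λ j∈ → let u , u∈us , j≡cu = ∈-map⁻ c (∈-deduplicate⁻ _≟_ (map c us) j∈)
                             in u , All.lookup adjacent u∈us , sym j≡cu)

-- Conditional colourings

min≡⊓ : ∀ m n → min m n ≡ m ⊓ n
min≡⊓ zero    n       = refl
min≡⊓ (suc m) zero    = refl
min≡⊓ (suc m) (suc n) = cong suc (min≡⊓ m n)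

min≤ˡ : ∀ m n → min m n ≤ m
min≤ˡ m n = subst (_≤ m) (sym (min≡⊓ m n)) (m⊓n≤m m n)

min≤ʳ : ∀ m n → min m n ≤ n
min≤ʳ m n = subst (_≤ n) (sym (min≡⊓ m n)) (m⊓n≤n m n)

r<k : ∀ {G k r} → ConditionalColoring G k r → r < k
r<k {G} {k} {r} χ =
  let v , r≤deg = ≤Δ⇒≤deg G r-pos r≤Δ in begin-strict
    r                      ≡⟨ sym (m≥n⇒m⊓n≡n r≤deg) ⟩
    deg G v ⊓ r            ≡⟨ sym (min≡⊓ (deg G v) r) ⟩
    min (deg G v) r        ≤⟨ C2 v ⟩
    nbrColours G colour v  <⟨ nbrColours<k G colour C1 v ⟩
    k                      ∎
  where
  open ConditionalColoring χ
  open ≤-Reasoning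

χ≡1+r : ∀ {G r} → ConditionalColoring G (suc r) r → χ[ r ] G ≡ suc r
χ≡1+r χ = χ , λ k k<1+r χ′ → <⇒≱ (r<k χ′) (m<1+n⇒m≤n k<1+r)

-- Middle graphs

∨≡true⁻ : ∀ x {y} → x ∨ y ≡ true → x ≡ true ⊎ y ≡ true
∨≡true⁻ true  _ = inj₁ refl
∨≡true⁻ false h = inj₂ h

module MiddleGraph {n m : ℕ} (ends : Fin m → Fin n × Fin n) where

  M : Graph
  M = middle n m ends

  vertex : Fin n → Fin (size M)
  vertex v = v ↑ˡ m

  edge : Fin m → Fin (size M)
  edge e = n ↑ʳ e

  Incident : Fin n → Fin m → Set
  Incident v e = v ≡ proj₁ (ends e) ⊎ v ≡ proj₂ (ends e)

  vertex-or-edge : ∀ x → (∃ λ v → vertex v ≡ x) ⊎ (∃ λ e → edge e ≡ x)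
  vertex-or-edge x with splitAt n x in eq
  ... | inj₁ v = inj₁ (v , splitAt⁻¹-↑ˡ eq)
  ... | inj₂ e = inj₂ (e , splitAt⁻¹-↑ʳ eq)

  vertex≢edge : ∀ {v e} → vertex v ≢ edge e
  vertex≢edge {v} {e} eq
    with () ← trans (sym (splitAt-↑ˡ n v m)) (trans (cong (splitAt n) eq) (splitAt-↑ʳ n m e))

  incident⁺ : ∀ {v e} → Incident v e → ⌊ v ≟ proj₁ (ends e) ⌋ ∨ ⌊ v ≟ proj₂ (ends e) ⌋ ≡ true
  incident⁺ {v} {e} v∈e with v ≟ proj₁ (ends e) | v ≟ proj₂ (ends e) | v∈e
  ... | yes _ | _     | _      = refl
  ... | no  _ | yes _ | _      = refl
  ... | no ¬p | no _  | inj₁ p = ⊥-elim (¬p p)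
  ... | no _  | no ¬q | inj₂ q = ⊥-elim (¬q q)

  incident⁻ : ∀ {v e} → ⌊ v ≟ proj₁ (ends e) ⌋ ∨ ⌊ v ≟ proj₂ (ends e) ⌋ ≡ true → Incident v e
  incident⁻ {v} {e} h with v ≟ proj₁ (ends e) | v ≟ proj₂ (ends e)
  ... | yes p | _     = inj₁ p
  ... | no _  | yes q = inj₂ q

  adj-vertex-edge : ∀ v e → Incident v e → adj M (vertex v) (edge e) ≡ true
  adj-vertex-edge v e v∈e rewrite splitAt-↑ˡ n v m | splitAt-↑ʳ n m e = incident⁺ v∈e

  adj-edge-vertex : ∀ v e → Incident v e → adj M (edge e) (vertex v) ≡ true
  adj-edge-vertex v e v∈e rewrite splitAt-↑ˡ n v m | splitAt-↑ʳ n m e = incident⁺ v∈e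

  adj-edge-edge : ∀ e f → e ≢ f → Incident (proj₁ (ends e)) f ⊎ Incident (proj₂ (ends e)) f →
    adj M (edge e) (edge f) ≡ true
  adj-edge-edge e f e≢f meet rewrite splitAt-↑ʳ n m e | splitAt-↑ʳ n m f with e ≟ f | meet
  ... | yes e≡f | _         = ⊥-elim (e≢f e≡f)
  ... | no _    | inj₁ meet₁ rewrite incident⁺ meet₁ = refl
  ... | no _    | inj₂ meet₂ rewrite incident⁺ meet₂ = ∨-zeroʳ _

  adj-vertex⁻ : ∀ {v y} → adj M (vertex v) y ≡ true → ∃ λ e → y ≡ edge e × Incident v e
  adj-vertex⁻ {v} {y} vy with vertex-or-edge y
  ... | inj₁ (w , refl) rewrite splitAt-↑ˡ n v m | splitAt-↑ˡ n w m with () ← vy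
  ... | inj₂ (e , refl) rewrite splitAt-↑ˡ n v m | splitAt-↑ʳ n m e = e , refl , incident⁻ vy

  module _ {k : ℕ} (f : Fin n → Fin k) (g : Fin m → Fin k) where

    colouring : Fin (size M) → Fin k
    colouring x = [ f , g ]′ (splitAt n x)

    colouring-vertex : ∀ v → colouring (vertex v) ≡ f v
    colouring-vertex v = cong [ f , g ]′ (splitAt-↑ˡ n v m)

    colouring-edge : ∀ e → colouring (edge e) ≡ g e
    colouring-edge e = cong [ f , g ]′ (splitAt-↑ʳ n m e)

    colouring-proper : (∀ {v e} → Incident v e → f v ≢ g e) →
      (∀ {e e′} → e ≢ e′ → Incident (proj₁ (ends e)) e′ ⊎ Incident (proj₂ (ends e)) e′ →
                 g e ≢ g e′) →
      Proper M colouring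
    colouring-proper vertex-edge edge-edge x y xy with splitAt n x | splitAt n y
    ... | inj₁ v | inj₁ w with () ← xy
    ... | inj₁ v | inj₂ e  = vertex-edge (incident⁻ xy)
    ... | inj₂ e | inj₁ v  = ≢-sym (vertex-edge (incident⁻ xy))
    ... | inj₂ e | inj₂ e′ with e ≟ e′ | xy
    ...   | yes _   | ()
    ...   | no e≢e′ | meet = edge-edge e≢e′ (Sum.map incident⁻ incident⁻ (∨≡true⁻ _ meet))

-- The cycle C_n

module Cycle (k : ℕ) where

  n : ℕ
  n = suc (suc k)

  next : Fin n → Fin n
  next e = proj₂ (cycleEdges n e)

  toℕ-next< : ∀ {e} → toℕ e < suc k → toℕ (next e) ≡ suc (toℕ e)
  toℕ-next< e<last = trans (toℕ-fromℕ< _) (m<n⇒m%n≡m (s≤s e<last))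

  toℕ-next-last : ∀ {e} → toℕ e ≡ suc k → toℕ (next e) ≡ 0
  toℕ-next-last e≡last = trans (toℕ-fromℕ< _) (trans (cong (λ t → suc t % n) e≡last) (n%n≡0 n))

  next-cases : ∀ e → (toℕ e < suc k × toℕ (next e) ≡ suc (toℕ e))
                   ⊎ (toℕ e ≡ suc k × toℕ (next e) ≡ 0)
  next-cases e with m≤n⇒m<n∨m≡n (≤-pred (toℕ<n e))
  ... | inj₁ e<last = inj₁ (e<last , toℕ-next< e<last)
  ... | inj₂ e≡last = inj₂ (e≡last , toℕ-next-last e≡last)

  along-next : {P : ℕ → ℕ → Set} → (∀ t → P t (suc t)) → P (suc k) 0 →
    ∀ e → P (toℕ e) (toℕ (next e))
  along-next step wrap e with next-cases e
  ... | inj₁ (_ , next≡) rewrite next≡ = step (toℕ e)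
  ... | inj₂ (e≡last , next≡) rewrite e≡last | next≡ = wrap

  along-next² : {P : ℕ → ℕ → ℕ → Set} → (∀ t → P t (suc t) (suc (suc t))) →
    P k (suc k) 0 → P (suc k) 0 1 → ∀ e → P (toℕ e) (toℕ (next e)) (toℕ (next (next e)))
  along-next² {P} step wrap₁ wrap₂ e with next-cases e | next-cases (next e)
  ... | inj₁ (_ , next≡) | inj₁ (_ , next²≡) rewrite next²≡ | next≡ = step (toℕ e)
  ... | inj₂ (e≡last , next≡) | inj₁ (_ , next²≡) rewrite next²≡ | next≡ | e≡last = wrap₂
  ... | inj₂ (_ , next≡) | inj₂ (next≡last , _) with () ← trans (sym next≡) next≡last
  ... | inj₁ (_ , next≡) | inj₂ (next≡last , next²≡)
    with suc-injective (trans (sym next≡) next≡last)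
  ...   | e≡k rewrite next²≡ | next≡last = subst (λ t → P t (suc k) 0) (sym e≡k) wrap₁

  next-injective : ∀ {d e} → next d ≡ next e → d ≡ e
  next-injective {d} {e} eq with next-cases d | next-cases e | cong toℕ eq
  ... | inj₁ (_ , d≡) | inj₁ (_ , e≡) | eq′ =
    toℕ-injective (suc-injective (trans (sym d≡) (trans eq′ e≡)))
  ... | inj₁ (_ , d≡) | inj₂ (_ , e≡) | eq′ with () ← trans (sym d≡) (trans eq′ e≡)
  ... | inj₂ (_ , d≡) | inj₁ (_ , e≡) | eq′ with () ← trans (sym e≡) (trans (sym eq′) d≡)
  ... | inj₂ (d≡last , _) | inj₂ (e≡last , _) | _ = toℕ-injective (trans d≡last (sym e≡last))

  next-surjective : ∀ e → ∃ λ d → next d ≡ e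
  next-surjective zero    = fromℕ (suc k) , toℕ-injective (toℕ-next-last (toℕ-fromℕ (suc k)))
  next-surjective (suc e) = inject₁ e , toℕ-injective (begin
    toℕ (next (inject₁ e))  ≡⟨ toℕ-next< (subst (_< suc k) (sym (toℕ-inject₁ e)) (toℕ<n e)) ⟩
    suc (toℕ (inject₁ e))   ≡⟨ cong suc (toℕ-inject₁ e) ⟩
    suc (toℕ e)             ∎)
    where open ≡-Reasoning

  next≢ : ∀ e → e ≢ next e
  next≢ e eq with next-cases e | cong toℕ eq
  ... | inj₁ (_ , next≡) | eq′ = 1+n≢n (sym (trans eq′ next≡))
  ... | inj₂ (e≡last , next≡) | eq′ with () ← trans (sym e≡last) (trans eq′ next≡)

module MiddleCycle (k : ℕ) where

  open Cycle k public
  open MiddleGraph (cycleEdges n) public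

  adj-next : ∀ e → adj M (edge e) (edge (next e)) ≡ true
  adj-next e = adj-edge-edge e (next e) (next≢ e) (inj₂ (inj₁ refl))

  adj-prev : ∀ e → adj M (edge (next e)) (edge e) ≡ true
  adj-prev e = adj-edge-edge (next e) e (≢-sym (next≢ e)) (inj₁ (inj₂ refl))

  in-triangle : ∀ x → ∃₂ λ u w → adj M x u ≡ true × adj M x w ≡ true × adj M u w ≡ true
  in-triangle x with vertex-or-edge x
  ... | inj₁ (v , refl) with next-surjective v
  ...   | d , refl = edge d , edge (next d) , adj-vertex-edge (next d) d (inj₂ refl) ,
                     adj-vertex-edge (next d) (next d) (inj₁ refl) , adj-next d
  in-triangle x | inj₂ (e , refl) =
    vertex (next e) , edge (next e) , adj-edge-vertex (next e) e (inj₂ refl) , adj-next e ,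
    adj-vertex-edge (next e) (next e) (inj₁ refl)

  proper⇒2≤nbrColours : ∀ {c} {colour : Fin (size M) → Fin c} → Proper M colour →
    ∀ x → 2 ≤ nbrColours M colour x
  proper⇒2≤nbrColours proper x =
    let u , w , xu , xw , uw = in-triangle x in triangle⇒2≤nbrColours M _ proper x {u} {w} xu xw uw

  3≤deg-edge : ∀ e → 3 ≤ deg M (edge e)
  3≤deg-edge e = length≤deg M (edge e) distinct
    (adj-edge-vertex e e (inj₁ refl) ∷ adj-edge-vertex (next e) e (inj₂ refl) ∷ adj-next e ∷ [])
    where
    distinct : Unique (vertex e ∷ vertex (next e) ∷ edge (next e) ∷ [])
    distinct = (next≢ e ∘ ↑ˡ-injective n e (next e) ∷ vertex≢edge ∷ [])
             ∷ (vertex≢edge ∷ []) ∷ [] ∷ []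

  deg-vertex≤2 : ∀ v → deg M (vertex v) ≤ 2
  deg-vertex≤2 v with next-surjective v
  ... | d , refl = deg≤length M (vertex (next d)) (edge (next d) ∷ edge d ∷ []) neighbour
    where
    neighbour : ∀ {y} → adj M (vertex (next d)) y ≡ true → y ∈ edge (next d) ∷ edge d ∷ []
    neighbour {y} vy with adj-vertex⁻ {v = next d} {y = y} vy
    ... | e , refl , inj₁ refl = here refl
    ... | e , refl , inj₂ eq = there (here (cong edge (sym (next-injective eq))))

  neighbours-of-next : Fin n → List (Fin (size M))
  neighbours-of-next d =
    edge d ∷ edge (next (next d)) ∷ vertex (next d) ∷ vertex (next (next d)) ∷ []

  adj-neighbours-of-next : ∀ d → All (λ u → adj M (edge (next d)) u ≡ true) (neighbours-of-next d)
  adj-neighbours-of-next d = adj-prev d ∷ adj-next (next d)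
    ∷ adj-edge-vertex (next d) (next d) (inj₁ refl)
    ∷ adj-edge-vertex (next (next d)) (next d) (inj₂ refl) ∷ []

  module _ {c : ℕ} (f g : ℕ → Fin c) where

    cyclicColouring : Fin (size M) → Fin c
    cyclicColouring = colouring (f ∘ toℕ) (g ∘ toℕ)

    cyclicColouring-vertex : ∀ v → cyclicColouring (vertex v) ≡ f (toℕ v)
    cyclicColouring-vertex = colouring-vertex (f ∘ toℕ) (g ∘ toℕ)

    cyclicColouring-edge : ∀ e → cyclicColouring (edge e) ≡ g (toℕ e)
    cyclicColouring-edge = colouring-edge (f ∘ toℕ) (g ∘ toℕ)

    cyclicColouring-proper : (∀ t → g t ≢ g (suc t)) → g (suc k) ≢ g 0 →
      (∀ t → f t ≢ g t) → (∀ t → f (suc t) ≢ g t) → f 0 ≢ g (suc k) → Proper M cyclicColouring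
    cyclicColouring-proper g-step g-wrap fg fg-step fg-wrap =
      colouring-proper _ _ vertex-edge edge-edge
      where
      vertex-edge : ∀ {v e} → Incident v e → f (toℕ v) ≢ g (toℕ e)
      vertex-edge {e = e} (inj₁ refl) = fg (toℕ e)
      vertex-edge {e = e} (inj₂ refl) = along-next {λ t u → f u ≢ g t} fg-step fg-wrap e
      edge-edge : ∀ {e e′} → e ≢ e′ → Incident e e′ ⊎ Incident (next e) e′ → g (toℕ e) ≢ g (toℕ e′)
      edge-edge e≢e′ (inj₁ (inj₁ e≡e′))         = ⊥-elim (e≢e′ e≡e′)
      edge-edge {e′ = e′} _ (inj₁ (inj₂ refl)) =
        ≢-sym (along-next {λ t u → g t ≢ g u} g-step g-wrap e′)
      edge-edge {e} _ (inj₂ (inj₁ refl))       = along-next {λ t u → g t ≢ g u} g-step g-wrap e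
      edge-edge e≢e′ (inj₂ (inj₂ next≡))       = ⊥-elim (e≢e′ (next-injective next≡))

    -- The neighbours of the edge-vertex at position t′ are the edge-vertices at t, t″ and the
    -- vertex-vertices at t′, t″, where t and t″ are the cyclic predecessor and successor of t′.
    EdgeSeesColours : ℕ → ℕ → ℕ → ℕ → Set
    EdgeSeesColours r t t′ t″ = r ≤ length (deduplicate _≟_ (g t ∷ g t″ ∷ f t′ ∷ f t″ ∷ []))

    cyclicColouring-nbrColours : ∀ r → (∀ t → EdgeSeesColours r t (suc t) (suc (suc t))) →
      EdgeSeesColours r k (suc k) 0 → EdgeSeesColours r (suc k) 0 1 →
      ∀ e → r ≤ nbrColours M cyclicColouring (edge e)
    cyclicColouring-nbrColours r step wrap₁ wrap₂ e with next-surjective e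
    ... | d , refl = ≤-trans (along-next² {EdgeSeesColours r} step wrap₁ wrap₂ d)
      (subst (λ cs → length (deduplicate _≟_ cs) ≤ nbrColours M cyclicColouring (edge (next d)))
         colours (distinctColours≤nbrColours M cyclicColouring (edge (next d)) _
                    (adj-neighbours-of-next d)))
      where
      colours : map cyclicColouring (neighbours-of-next d)
              ≡ g (toℕ d) ∷ g (toℕ (next (next d))) ∷ f (toℕ (next d))
                ∷ f (toℕ (next (next d))) ∷ []
      colours rewrite cyclicColouring-edge d | cyclicColouring-edge (next (next d))
                    | cyclicColouring-vertex (next d) | cyclicColouring-vertex (next (next d))
                    = refl

-- Colourings of M(C_n)

odd : ℕ → Bool
odd zero    = false
odd (suc t) = not (odd t)

module _ {j : ℕ} where

  bit : Bool → Fin (3 + j)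
  bit false = # 0
  bit true  = # 1

  bit≢bit-not : ∀ b → bit b ≢ bit (not b)
  bit≢bit-not false ()
  bit≢bit-not true  ()

  bit≢2 : ∀ b → bit b ≢ # 2
  bit≢2 false ()
  bit≢2 true  ()

  edgeColour : ℕ → Fin (3 + j)
  edgeColour zero    = # 2
  edgeColour (suc t) = bit (odd t)

  edgeColour-step : ∀ t → edgeColour t ≢ edgeColour (suc t)
  edgeColour-step zero    = λ ()
  edgeColour-step (suc t) = bit≢bit-not (odd t)

  edgeColour-wrap : ∀ t → edgeColour (suc t) ≢ edgeColour 0
  edgeColour-wrap t = bit≢2 (odd t)

vertexColour₃ : ℕ → ℕ → Fin 3
vertexColour₃ k zero          = bit (odd (suc k))
vertexColour₃ k 1             = # 1
vertexColour₃ k (suc (suc t)) = # 2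

vertexColour₄ : ℕ → Fin 4
vertexColour₄ zero          = # 3
vertexColour₄ 1             = # 1
vertexColour₄ (suc (suc t)) = if odd t then # 2 else # 3

module _ (k : ℕ) where

  open MiddleCycle k

  3≤Δ : 3 ≤ Δ M
  3≤Δ = ≤-trans (3≤deg-edge zero) (deg≤Δ M (edge zero))

  colouring₃ : Fin (size M) → Fin 3
  colouring₃ = cyclicColouring (vertexColour₃ k) edgeColour

  colouring₃-proper : Proper M colouring₃
  colouring₃-proper = cyclicColouring-proper _ _ edgeColour-step (edgeColour-wrap k)
    vertex-edge vertex-next-edge (≢-sym (bit≢bit-not (odd k)))
    where
    vertex-edge : ∀ t → vertexColour₃ k t ≢ edgeColour t
    vertex-edge zero          = bit≢2 (odd (suc k))
    vertex-edge 1             = λ ()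
    vertex-edge (suc (suc t)) = ≢-sym (bit≢2 (odd (suc t)))
    vertex-next-edge : ∀ t → vertexColour₃ k (suc t) ≢ edgeColour t
    vertex-next-edge zero    = λ ()
    vertex-next-edge (suc t) = ≢-sym (bit≢2 (odd t))

  conditional-3-2 : ConditionalColoring M 3 2
  conditional-3-2 = record
    { r-pos  = s≤s z≤n
    ; r≤Δ    = ≤-trans (s≤s (s≤s z≤n)) 3≤Δ
    ; r≤k    = s≤s (s≤s z≤n)
    ; colour = colouring₃
    ; surj   = surj
    ; C1     = colouring₃-proper
    ; C2     = λ x → ≤-trans (min≤ʳ (deg M x) 2) (proper⇒2≤nbrColours colouring₃-proper x)
    }
    where
    surj : ∀ i → ∃ λ x → colouring₃ x ≡ i
    surj zero = edge (suc zero) , cyclicColouring-edge (vertexColour₃ k) edgeColour (suc zero)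
    surj (suc zero) =
      vertex (suc zero) , cyclicColouring-vertex (vertexColour₃ k) edgeColour (suc zero)
    surj (suc (suc zero)) = edge zero , cyclicColouring-edge (vertexColour₃ k) edgeColour zero

module _ (m : ℕ) where

  open MiddleCycle (suc m)

  colouring₄ : Fin (size M) → Fin 4
  colouring₄ = cyclicColouring vertexColour₄ edgeColour

  colouring₄-proper : Proper M colouring₄
  colouring₄-proper = cyclicColouring-proper _ _ edgeColour-step (edgeColour-wrap (suc m))
    vertex-edge vertex-next-edge (≢-sym (bit≢3 (odd (suc m))))
    where
    bit≢3 : ∀ b → bit b ≢ # 3
    bit≢3 false ()
    bit≢3 true  ()
    two-or-three≢bit : ∀ b b′ → (if b then # 2 else # 3) ≢ bit b′
    two-or-three≢bit true  false ()
    two-or-three≢bit true  true  ()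
    two-or-three≢bit false false ()
    two-or-three≢bit false true  ()
    vertex-edge : ∀ t → vertexColour₄ t ≢ edgeColour t
    vertex-edge zero          = λ ()
    vertex-edge 1             = λ ()
    vertex-edge (suc (suc t)) = two-or-three≢bit (odd t) (odd (suc t))
    vertex-next-edge : ∀ t → vertexColour₄ (suc t) ≢ edgeColour t
    vertex-next-edge zero    = λ ()
    vertex-next-edge (suc t) = two-or-three≢bit (odd t) (odd t)

  colouring₄-edge : ∀ e → 3 ≤ nbrColours M colouring₄ (edge e)
  colouring₄-edge = cyclicColouring-nbrColours vertexColour₄ edgeColour 3 step wrap₁ wrap₂
    where
    -- Once the parities are fixed the four colours are closed terms and deduplicate evaluates.
    step : ∀ t → EdgeSeesColours vertexColour₄ edgeColour 3 t (suc t) (suc (suc t))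
    step zero = s≤s (s≤s (s≤s z≤n))
    step (suc u) with odd u
    ... | true  = s≤s (s≤s (s≤s z≤n))
    ... | false = s≤s (s≤s (s≤s z≤n))
    wrap₁ : EdgeSeesColours vertexColour₄ edgeColour 3 (suc m) (suc (suc m)) 0
    wrap₁ with odd m
    ... | true  = s≤s (s≤s (s≤s z≤n))
    ... | false = s≤s (s≤s (s≤s z≤n))
    wrap₂ : EdgeSeesColours vertexColour₄ edgeColour 3 (suc (suc m)) 0 1
    wrap₂ with odd (suc m)
    ... | true  = s≤s (s≤s (s≤s z≤n))
    ... | false = s≤s (s≤s (s≤s z≤n))

  conditional-4-3 : ConditionalColoring M 4 3
  conditional-4-3 = record
    { r-pos  = s≤s z≤n
    ; r≤Δ    = 3≤Δ (suc m)
    ; r≤k    = s≤s (s≤s (s≤s z≤n))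
    ; colour = colouring₄
    ; surj   = surj
    ; C1     = colouring₄-proper
    ; C2     = C2
    }
    where
    surj : ∀ i → ∃ λ x → colouring₄ x ≡ i
    surj zero = edge (suc zero) , cyclicColouring-edge vertexColour₄ edgeColour (suc zero)
    surj (suc zero) = vertex (suc zero) , cyclicColouring-vertex vertexColour₄ edgeColour (suc zero)
    surj (suc (suc zero)) = edge zero , cyclicColouring-edge vertexColour₄ edgeColour zero
    surj (suc (suc (suc zero))) = vertex zero , cyclicColouring-vertex vertexColour₄ edgeColour zero
    C2 : ∀ x → min (deg M x) 3 ≤ nbrColours M colouring₄ x
    C2 x with vertex-or-edge x
    ... | inj₁ (v , refl) = ≤-trans (min≤ˡ _ 3) (≤-trans (deg-vertex≤2 v)
                              (proper⇒2≤nbrColours colouring₄-proper (vertex v)))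
    ... | inj₂ (e , refl) = ≤-trans (min≤ʳ _ 3) (colouring₄-edge e)

proposition3p7 : ∀ (n : ℕ) → 4 ≤ n →
    (χ[ 2 ] middleCycle n ≡ 3) × (χ[ 3 ] middleCycle n ≡ 4)
proposition3p7 (suc (suc (suc (suc m)))) _ =
  χ≡1+r (conditional-3-2 (suc (suc m))) , χ≡1+r (conditional-4-3 (suc m))
proposition3p7 (suc (suc (suc zero))) (s≤s (s≤s (s≤s ())))
proposition3p7 (suc (suc zero)) (s≤s (s≤s ()))
proposition3p7 (suc zero) (s≤s ())
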